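{- Let $a,b,c,n,p,m$ be integers with $0<b<a$, $0\leq c<n$, $ca<m<ca+(n-c)b$ and $p\geq 2$. Let $(x_i)_{i=1}^n\in\mathbb{N}^n$ be a non-increasing sequence with $\sum_{i=1}^n x_i\leq m$, $0\leq x_i\leq a$ for $1\leq i\leq c$, and $0\leq x_i\leq b$ for $c+1\leq i\leq n$. Then $$\sum_{i=1}^n x_i^p\leq ca^p+(m-ca)b^{p-1}.$$ -}

module Defs where

open import Data.Nat using (ℕ; zero; suc; _+_; _≤_)
open import Data.Fin using (Fin; toℕ)
open import Data.Fin.Properties using ()

sumFin : (n : ℕ) → (Fin n → ℕ) → ℕ
sumFin zero    f = 0
sumFin (suc n) f = f Fin.zero + sumFin n (λ i → f (Fin.suc i))

-- non-increasing sequence indexed by Fin n (index 0 ↔ x_1)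
NonIncreasing : {n : ℕ} → (Fin n → ℕ) → Set
NonIncreasing {n} x = ∀ (i j : Fin n) → toℕ i ≤ toℕ j → x j ≤ x i

{-# OPTIONS --safe #-}
module Submission where

open import Defs
open import Data.Bool using (true; false; if_then_else_; T)
open import Data.Fin using (Fin; toℕ)
import Data.Fin as Fin
open import Data.Nat using (ℕ; zero; suc; _+_; _*_; _∸_; _^_; _≤_; _<_; _<ᵇ_; z≤n; s≤s)
open import Data.Nat.Properties
open import Algebra.Properties.CommutativeSemigroup +-commutativeSemigroup using (interchange)
open import Data.Nat.Tactic.RingSolver using (solve-∀)
open import Relation.Binary.PropositionalEquality

-- Write p = q + 1 and w = (a, …, a, 0, …, 0) with c copies of a. Every index satisfies
-- x_i^p + w_i b^q ≤ w_i a^q + x_i b^q: for i ≥ c because x_i ≤ b, and for i < c because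
-- (a − x_i)(a^q − b^q) ≥ 0. Summing gives Σ x_i^p + c a b^q ≤ c a^p + (Σ x_i) b^q
-- ≤ c a^p + m b^q, and writing m = (m − c a) + c a and cancelling c a b^q leaves the bound.

sumFin-mono-≤ : ∀ n {f g : Fin n → ℕ} → (∀ i → f i ≤ g i) → sumFin n f ≤ sumFin n g
sumFin-mono-≤ zero    f≤g = z≤n
sumFin-mono-≤ (suc n) f≤g = +-mono-≤ (f≤g Fin.zero) (sumFin-mono-≤ n (λ i → f≤g (Fin.suc i)))

sumFin-+ : ∀ n (f g : Fin n → ℕ) → sumFin n (λ i → f i + g i) ≡ sumFin n f + sumFin n g
sumFin-+ zero    f g = refl
sumFin-+ (suc n) f g =
  trans (cong (f Fin.zero + g Fin.zero +_) (sumFin-+ n (λ i → f (Fin.suc i)) (λ i → g (Fin.suc i))))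
        (interchange (f Fin.zero) (g Fin.zero) _ _)

sumFin-*ʳ : ∀ n (f : Fin n → ℕ) k → sumFin n (λ i → f i * k) ≡ sumFin n f * k
sumFin-*ʳ zero    f k = refl
sumFin-*ʳ (suc n) f k =
  trans (cong (f Fin.zero * k +_) (sumFin-*ʳ n (λ i → f (Fin.suc i)) k))
        (sym (*-distribʳ-+ k (f Fin.zero) _))

constBelow : ∀ {n} → ℕ → ℕ → Fin n → ℕ
constBelow c k i = if toℕ i <ᵇ c then k else 0

sumFin-constBelow : ∀ {n c} k → c ≤ n → sumFin n (constBelow c k) ≡ c * k
sumFin-constBelow {zero}  k z≤n       = refl
sumFin-constBelow {suc n} k z≤n       = sumFin-constBelow {n} k z≤n
sumFin-constBelow {suc n} k (s≤s c≤n) = cong (k +_) (sumFin-constBelow k c≤n)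

x≤b⇒x^[1+q]≤x*b^q : ∀ {x b} q → x ≤ b → x ^ suc q ≤ x * b ^ q
x≤b⇒x^[1+q]≤x*b^q {x} q x≤b = *-monoʳ-≤ x (^-monoˡ-≤ q x≤b)

x^[1+q]+a*b^q≤a^[1+q]+x*b^q : ∀ {x a b} q → x ≤ a → b ≤ a →
                               x ^ suc q + a * b ^ q ≤ a ^ suc q + x * b ^ q
x^[1+q]+a*b^q≤a^[1+q]+x*b^q {x} {a} {b} q x≤a b≤a = begin
  x ^ suc q + a * b ^ q             ≡⟨ cong (λ y → x ^ suc q + y * b ^ q) (m+[n∸m]≡n x≤a) ⟨
  x ^ suc q + (x + d) * b ^ q       ≡⟨ regroup x d (x ^ q) (b ^ q) ⟩
  (x * x ^ q + d * b ^ q) + x * b ^ q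
    ≤⟨ +-monoˡ-≤ (x * b ^ q) (+-mono-≤ (*-monoʳ-≤ x (^-monoˡ-≤ q x≤a))
                                       (*-monoʳ-≤ d (^-monoˡ-≤ q b≤a))) ⟩
  (x * a ^ q + d * a ^ q) + x * b ^ q ≡⟨ cong (_+ x * b ^ q) (*-distribʳ-+ (a ^ q) x d) ⟨
  (x + d) * a ^ q + x * b ^ q       ≡⟨ cong (λ y → y * a ^ q + x * b ^ q) (m+[n∸m]≡n x≤a) ⟩
  a ^ suc q + x * b ^ q             ∎
  where
  open ≤-Reasoning
  d = a ∸ x
  regroup : ∀ x d X B → x * X + (x + d) * B ≡ (x * X + d * B) + x * B
  regroup = solve-∀

module _ {n} (a b c q : ℕ) (x : Fin n → ℕ) (b≤a : b ≤ a)
         (x≤a : ∀ i → toℕ i < c → x i ≤ a) (x≤b : ∀ i → c ≤ toℕ i → x i ≤ b) where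

  private
    w : Fin n → ℕ
    w = constBelow c a

  exchange-pointwise : ∀ i → x i ^ suc q + w i * b ^ q ≤ w i * a ^ q + x i * b ^ q
  exchange-pointwise i with toℕ i <ᵇ c in eq
  ... | true  = x^[1+q]+a*b^q≤a^[1+q]+x*b^q q (x≤a i (<ᵇ⇒< _ _ (subst T (sym eq) _))) b≤a
  ... | false = ≤-trans (≤-reflexive (+-identityʳ _))
                        (x≤b⇒x^[1+q]≤x*b^q q (x≤b i (≮⇒≥ (λ i<c → subst T eq (<⇒<ᵇ i<c)))))

  exchange-sum : c ≤ n →
    sumFin n (λ i → x i ^ suc q) + c * a * b ^ q ≤ c * a * a ^ q + sumFin n x * b ^ q
  exchange-sum c≤n = begin
    sumFin n (λ i → x i ^ suc q) + c * a * b ^ q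
      ≡⟨ cong (λ s → sumFin n (λ i → x i ^ suc q) + s * b ^ q) (sumFin-constBelow a c≤n) ⟨
    sumFin n (λ i → x i ^ suc q) + sumFin n w * b ^ q
      ≡⟨ cong (sumFin n (λ i → x i ^ suc q) +_) (sumFin-*ʳ n w (b ^ q)) ⟨
    sumFin n (λ i → x i ^ suc q) + sumFin n (λ i → w i * b ^ q)
      ≡⟨ sumFin-+ n _ _ ⟨
    sumFin n (λ i → x i ^ suc q + w i * b ^ q)
      ≤⟨ sumFin-mono-≤ n exchange-pointwise ⟩
    sumFin n (λ i → w i * a ^ q + x i * b ^ q)
      ≡⟨ sumFin-+ n _ _ ⟩
    sumFin n (λ i → w i * a ^ q) + sumFin n (λ i → x i * b ^ q)
      ≡⟨ cong₂ _+_ (sumFin-*ʳ n w (a ^ q)) (sumFin-*ʳ n x (b ^ q)) ⟩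
    sumFin n w * a ^ q + sumFin n x * b ^ q
      ≡⟨ cong (λ s → s * a ^ q + sumFin n x * b ^ q) (sumFin-constBelow a c≤n) ⟩
    c * a * a ^ q + sumFin n x * b ^ q ∎
    where open ≤-Reasoning

lemma3p6 : (a b c n p m : ℕ) → 0 < b → b < a → c < n →
           c * a < m → m < c * a + (n ∸ c) * b → 2 ≤ p →
           (x : Fin n → ℕ) → NonIncreasing x → sumFin n x ≤ m →
           (∀ (i : Fin n) → toℕ i < c → x i ≤ a) →
           (∀ (i : Fin n) → c ≤ toℕ i → x i ≤ b) →
           sumFin n (λ i → x i ^ p) ≤ c * a ^ p + (m ∸ c * a) * b ^ (p ∸ 1)
lemma3p6 a b c n (suc q) m _ b<a c<n ca<m _ _ x _ Σx≤m x≤a x≤b =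
  +-cancelʳ-≤ (c * a * b ^ q) _ _ (begin
    sumFin n (λ i → x i ^ suc q) + c * a * b ^ q
      ≤⟨ exchange-sum a b c q x (<⇒≤ b<a) x≤a x≤b (<⇒≤ c<n) ⟩
    c * a * a ^ q + sumFin n x * b ^ q
      ≤⟨ +-monoʳ-≤ (c * a * a ^ q) (*-monoˡ-≤ (b ^ q) Σx≤m) ⟩
    c * a * a ^ q + m * b ^ q
      ≡⟨ cong (λ y → c * a * a ^ q + y * b ^ q) (m∸n+n≡m (<⇒≤ ca<m)) ⟨
    c * a * a ^ q + (m ∸ c * a + c * a) * b ^ q
      ≡⟨ regroup c a (a ^ q) (m ∸ c * a) (b ^ q) ⟩
    c * a ^ suc q + (m ∸ c * a) * b ^ q + c * a * b ^ q ∎)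
  where
  open ≤-Reasoning
  regroup : ∀ c a A D B → c * a * A + (D + c * a) * B ≡ c * (a * A) + D * B + c * a * B
  regroup = solve-∀
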